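{- Let $A$ be an arena, with chosen canonical representatives $\hat{\mathsf x}$ of its complete symmetry classes. For complete symmetry classes $\mathsf x_A,\mathsf y_A$ of $A$, let $\mathrm{wit}^+(\mathsf x_A,\mathsf y_A)$ be the set of $+$-covered configurations $x_1\parallel x_2$ of $\mathrm{cc}_A$ such that $x_1\cong^-_A\hat{\mathsf x}_A$ and $x_2\cong^+_A\hat{\mathsf y}_A$. Then $\mathrm{wit}^+(\mathsf x_A,\mathsf y_A)$ has exactly one element if $\mathsf x_A=\mathsf y_A$, and is empty otherwise.
   Context: Event structures: countable set of events, partial order $\le$ with finite down-sets, irreflexive symmetric conflict $\#$ with $e_1\#e_2\le e_2'\Rightarrow e_1\#e_2'$; configurations are finite down-closed conflict-free sets ($\mathscr C(E)$); $\rightarrow$ is immediate causality. An isomorphism family: bijections between configurations, containing identities, closed under composition and inverse, each with a unique restriction to any sub-configuration of its domain and some extension to any configuration containing its domain; $\theta:x\cong y$; symmetry classes are classes under existence of a symmetry. A tcg $A$: such a structure with a symmetry-preserved polarity $\mathrm{pol}_A:|A|\to\{ -,+\}$ and subfamilies $\tilde A_+,\tilde A_-$ (positive/negative symmetries, written $\cong^+_A,\cong^-_A$) meeting only in identities, each closed within $\tilde A$ under extension by pairs of events of its own polarity. A game adds a symmetry-invariant payoff $\kappa_A:\mathscr C(A)\to\{ -1,0,+1\}$; payoff-$0$ configurations/classes are complete. A configuration $x$ is canonical if each $\theta:x\cong_Ax$ factors uniquely as $\theta^+\circ\theta^-$ with $\theta^-:x\cong^-_Ax$, $\theta^+:x\cong^+_Ax$;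 games are representable: each complete symmetry class $\mathsf x$ has a chosen canonical representative $\hat{\mathsf x}\in\mathsf x$. An arena is a game with all minimal events negative, $\kappa_A(\emptyset)\ge0$, $a_1\rightarrow_A a_2\Rightarrow\mathrm{pol}(a_1)\ne\mathrm{pol}(a_2)$, and any two events below a common event comparable. The game $A\vdash A$ has events $\{1,2\}\times|A|$, causality/conflict within components as in $A$, $\mathrm{pol}(1,a)=-\mathrm{pol}_A(a)$, $\mathrm{pol}(2,a)=\mathrm{pol}_A(a)$, configurations $x_1\parallel x_2$. The copycat strategy $\mathrm{cc}_A$ has events $\{1,2\}\times|A|$, identity display into $A\vdash A$ (polarities inherited); causality $(i,a)\le(j,a')$ iff $(i,a)=(j,a')$, or $a<_Aa'$, or $a=a'$ with $(i,a)$ negative and $(j,a')$ positive; conflict $(i,a)\#(j,a')$ iff $a\#_Aa'$; symmetries the bijections $\theta_1\parallel\theta_2:x_1\parallel x_2\cong y_1\parallel y_2$ between its configurations with $\theta_1:x_1\cong_Ay_1$, $\theta_2:x_2\cong_Ay_2$, $\theta_1\cap\theta_2:x_1\cap x_2\cong_Ay_1\cap y_2$. A configuration of $\mathrm{cc}_A$ is $+$-covered if all its maximal events are positive. -}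

module Defs where

open import Data.Nat using (ℕ)
open import Data.Product using (Σ; ∃; _×_; _,_; proj₁; proj₂)
open import Data.Sum using (_⊎_)
open import Data.Empty using (⊥)
open import Data.List using (List)
open import Data.List.Membership.Propositional using (_∈_)
open import Relation.Binary.PropositionalEquality using (_≡_; _≢_)
open import Relation.Nullary using (¬_)

Subset : Set → Set₁
Subset E = E → Set

GRel : Set → Set₁
GRel E = E → E → Set

module _ {E : Set} where

  _⊆_ : Subset E → Subset E → Set
  x ⊆ y = ∀ e → x e → y e

  _≐_ : Subset E → Subset E → Set
  x ≐ y = (x ⊆ y) × (y ⊆ x)

  ∅ : Subset E
  ∅ _ = ⊥

  Finite : Subset E → Set
  Finite x = Σ (List E) λ l → ∀ e → x e → e ∈ l

  _⊆ᵣ_ : GRel E → GRel E → Set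
  θ ⊆ᵣ φ = ∀ a b → θ a b → φ a b

  _≐ᵣ_ : GRel E → GRel E → Set
  θ ≐ᵣ φ = (θ ⊆ᵣ φ) × (φ ⊆ᵣ θ)

  dom : GRel E → Subset E
  dom θ a = ∃ λ b → θ a b

  cod : GRel E → Subset E
  cod θ b = ∃ λ a → θ a b

  idOn : Subset E → GRel E
  idOn x a b = x a × a ≡ b

  _∘ᵣ_ : GRel E → GRel E → GRel E
  (φ ∘ᵣ θ) a c = ∃ λ b → θ a b × φ b c

  inv : GRel E → GRel E
  inv θ a b = θ b a

  restrict : GRel E → Subset E → GRel E
  restrict θ x a b = x a × θ a b

  IsPartialBij : GRel E → Set
  IsPartialBij θ = (∀ {a b b'} → θ a b → θ a b' → b ≡ b')
                 × (∀ {a a' b} → θ a b → θ a' b → a ≡ a')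

  Bij : GRel E → Subset E → Subset E → Set
  Bij θ x y = IsPartialBij θ × (dom θ ≐ x) × (cod θ ≐ y)

  record IsConfigOf (_≤_ _#_ : E → E → Set) (x : Subset E) : Set where
    field
      finite       : Finite x
      downClosed   : ∀ {e e'} → e' ≤ e → x e → x e'
      conflictFree : ∀ {e e'} → x e → x e' → ¬ (e # e')

  record IsIsoFamily (IsConfig : Subset E → Set) (S : GRel E → Set) : Set₁ where
    field
      resp      : ∀ {θ φ} → θ ≐ᵣ φ → S θ → S φ
      bij       : ∀ {θ} → S θ → IsPartialBij θ
      domConfig : ∀ {θ} → S θ → IsConfig (dom θ)
      codConfig : ∀ {θ} → S θ → IsConfig (cod θ)
      identity  : ∀ {x} → IsConfig x → S (idOn x)
      compose   : ∀ {θ φ} → S θ → S φ → cod θ ≐ dom φ → S (φ ∘ᵣ θ)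
      inverse   : ∀ {θ} → S θ → S (inv θ)
      restriction : ∀ {θ x} → S θ → IsConfig x → x ⊆ dom θ → S (restrict θ x)
      extension : ∀ {θ x} → S θ → IsConfig x → dom θ ⊆ x →
                  ∃ λ φ → S φ × (θ ⊆ᵣ φ) × (dom φ ≐ x)

record EventStructure : Set₁ where
  field
    Ev        : Set
    code      : Ev → ℕ                       -- countability
    code-inj  : ∀ {a b} → code a ≡ code b → a ≡ b
    _≤_       : Ev → Ev → Set
    ≤-refl    : ∀ {a} → a ≤ a
    ≤-trans   : ∀ {a b c} → a ≤ b → b ≤ c → a ≤ c
    ≤-antisym : ∀ {a b} → a ≤ b → b ≤ a → a ≡ b
    down-fin  : ∀ a → Finite (λ b → b ≤ a)
    _#_       : Ev → Ev → Set
    #-irrefl  : ∀ {a} → ¬ (a # a)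
    #-sym     : ∀ {a b} → a # b → b # a
    #-inh     : ∀ {a b b'} → a # b → b ≤ b' → a # b'

  _<_ : Ev → Ev → Set
  a < b = (a ≤ b) × (a ≢ b)

  _⇀_ : Ev → Ev → Set
  a ⇀ b = (a < b) × (∀ c → a < c → c < b → ⊥)

  IsConfig : Subset Ev → Set
  IsConfig = IsConfigOf _≤_ _#_

data Pol : Set where
  minus plus : Pol

data Payoff : Set where
  pneg pzero ppos : Payoff      -- -1, 0, +1

record TCG : Set₂ where
  field
    es : EventStructure
  open EventStructure es public
  field
    S  : GRel Ev → Set
    S⁺ : GRel Ev → Set
    S⁻ : GRel Ev → Set
    isoS  : IsIsoFamily IsConfig S
    isoS⁺ : IsIsoFamily IsConfig S⁺
    isoS⁻ : IsIsoFamily IsConfig S⁻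
    S⁺⊆S : ∀ {θ} → S⁺ θ → S θ
    S⁻⊆S : ∀ {θ} → S⁻ θ → S θ
    pol      : Ev → Pol
    pol-pres : ∀ {θ a b} → S θ → θ a b → pol a ≡ pol b
    meet-id  : ∀ {θ a b} → S⁺ θ → S⁻ θ → θ a b → a ≡ b
    ext⁺ : ∀ {θ φ} → S⁺ θ → S φ → θ ⊆ᵣ φ →
           (∀ a b → φ a b → ¬ θ a b → pol a ≡ plus) → S⁺ φ
    ext⁻ : ∀ {θ φ} → S⁻ θ → S φ → θ ⊆ᵣ φ →
           (∀ a b → φ a b → ¬ θ a b → pol a ≡ minus) → S⁻ φ

  _≅_ : Subset Ev → Subset Ev → Set₁
  x ≅ y = ∃ λ θ → S θ × Bij θ x y

  _≅⁺_ : Subset Ev → Subset Ev → Set₁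
  x ≅⁺ y = ∃ λ θ → S⁺ θ × Bij θ x y

  _≅⁻_ : Subset Ev → Subset Ev → Set₁
  x ≅⁻ y = ∃ λ θ → S⁻ θ × Bij θ x y

  Canonical : Subset Ev → Set₁
  Canonical x =
    ∀ θ → S θ → Bij θ x x →
      (∃ λ θ⁻ → ∃ λ θ⁺ → S⁻ θ⁻ × Bij θ⁻ x x × S⁺ θ⁺ × Bij θ⁺ x x
                         × (θ ≐ᵣ (θ⁺ ∘ᵣ θ⁻)))
      × (∀ θ⁻ θ⁺ ψ⁻ ψ⁺ →
           S⁻ θ⁻ → Bij θ⁻ x x → S⁺ θ⁺ → Bij θ⁺ x x → θ ≐ᵣ (θ⁺ ∘ᵣ θ⁻) →
           S⁻ ψ⁻ → Bij ψ⁻ x x → S⁺ ψ⁺ → Bij ψ⁺ x x → θ ≐ᵣ (ψ⁺ ∘ᵣ ψ⁻) →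
           (θ⁻ ≐ᵣ ψ⁻) × (θ⁺ ≐ᵣ ψ⁺))

record Game : Set₂ where
  field
    tcg : TCG
  open TCG tcg public
  field
    κ     : Subset Ev → Payoff
    κ-inv : ∀ {x y} → x ≅ y → κ x ≡ κ y

  Complete : Subset Ev → Set
  Complete x = IsConfig x × (κ x ≡ pzero)

record Arena : Set₂ where
  field
    game : Game
  open Game game public
  field
    min-neg    : ∀ a → (∀ b → b ≤ a → b ≡ a) → pol a ≡ minus
    κ-empty    : κ ∅ ≢ pneg
    alternate  : ∀ {a b} → a ⇀ b → pol a ≢ pol b
    forestlike : ∀ {a b c} → a ≤ c → b ≤ c → (a ≤ b) ⊎ (b ≤ a)
    hat        : (x : Subset Ev) → Complete x → Subset Ev
    hat-config : ∀ x (cx : Complete x) → IsConfig (hat x cx)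
    hat-member : ∀ x (cx : Complete x) → x ≅ hat x cx
    hat-canon  : ∀ x (cx : Complete x) → Canonical (hat x cx)
    hat-class  : ∀ x y (cx : Complete x) (cy : Complete y) →
                 x ≅ y → hat x cx ≐ hat y cy

data Side : Set where
  one two : Side

module Copycat (A : Arena) where
  open Arena A

  flip : Pol → Pol
  flip minus = plus
  flip plus  = minus

  CEv : Set
  CEv = Side × Ev

  polcc : CEv → Pol
  polcc (one , a) = flip (pol a)
  polcc (two , a) = pol a

  _≤cc_ : CEv → CEv → Set
  (i , a) ≤cc (j , a') =
    ((i , a) ≡ (j , a'))
    ⊎ (a < a')
    ⊎ ((a ≡ a') × (polcc (i , a) ≡ minus) × (polcc (j , a') ≡ plus))

  _#cc_ : CEv → CEv → Set
  (i , a) #cc (j , a') = a # a'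

  IsConfigCC : Subset CEv → Set
  IsConfigCC = IsConfigOf _≤cc_ _#cc_

  left right : Subset CEv → Subset Ev
  left  z a = z (one , a)
  right z a = z (two , a)

  Maximal : Subset CEv → CEv → Set
  Maximal z e = z e × (∀ e' → z e' → e ≤cc e' → e' ≡ e)

  PlusCovered : Subset CEv → Set
  PlusCovered z = ∀ e → Maximal z e → polcc e ≡ plus

  wit⁺ : Subset Ev → Subset Ev → Subset CEv → Set₁
  wit⁺ xh yh z = IsConfigCC z × PlusCovered z
               × (left z ≅⁻ xh) × (right z ≅⁺ yh)

-- In a +-covered configuration x₁ ∥ x₂ of copycat every positive event of one side has its
-- negative copy on the other side, and maximality of negative events is excluded, so
-- (classically) x₁ = x₂.  Hence a witness forces x̂ ≅ x₁ = x₂ ≅ ŷ, and for x̂ = ŷ the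
-- diagonal x̂ ∥ x̂ is one.  For uniqueness the equality x₁ = x₂ must be obtained
-- constructively: the symmetry x₁ ≅ x̂ ≅ x₂ preserves polarity, so by finiteness the
-- inclusions of positive (resp. negative) copies are equalities.  Then x₁ ≅⁻ x̂ and
-- x₁ ≅⁺ x̂; canonicity of x̂ turns these into a single symmetry that is both negative and
-- positive, i.e. an identity, so x₁ = x̂.
module Submission where

open import Defs
open import Data.Empty using (⊥-elim)
open import Data.Fin using (Fin; toℕ)
open import Data.Fin.Properties using (pigeonhole)
open import Data.List using (List; map; _++_; length; lookup)
open import Data.List.Membership.Propositional using (_∈_)
open import Data.List.Membership.Propositional.Properties using (∈-map⁺; ∈-++⁺ˡ; ∈-++⁺ʳ)
open import Data.List.Relation.Unary.All using (All; tabulate; sequenceM)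
import Data.List.Relation.Unary.All as All
open import Data.List.Relation.Unary.Any using (index)
open import Data.List.Relation.Unary.Any.Properties using (lookup-index)
open import Data.Nat using (ℕ; zero; suc)
open import Data.Nat.Properties using (n<1+n; <⇒≢)
open import Data.Product using (Σ; ∃; _×_; _,_; proj₁; proj₂)
open import Data.Sum using (inj₁; inj₂)
open import Function using (const)
open import Level using (0ℓ)
open import Relation.Binary.PropositionalEquality using (_≡_; _≢_; refl; sym; trans; cong; subst)
open import Relation.Nullary using (¬_; Dec; yes; no)
open import Relation.Nullary.Decidable using (¬¬-excluded-middle)
open import Relation.Nullary.Negation using (¬¬-map; ¬¬-Monad)

module _ {E : Set} where

  ≐-refl : {x : Subset E} → x ≐ x
  ≐-refl = (λ _ p → p) , (λ _ p → p)

  ≐-sym : {x y : Subset E} → x ≐ y → y ≐ x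
  ≐-sym (f , g) = g , f

  ≐-trans : {x y z : Subset E} → x ≐ y → y ≐ z → x ≐ z
  ≐-trans (f , g) (h , k) = (λ e p → h e (f e p)) , (λ e p → g e (k e p))

  module _ {θ : GRel E} {x y : Subset E} (θ-bij : Bij θ x y) where

    Bij-functional : ∀ {a b b'} → θ a b → θ a b' → b ≡ b'
    Bij-functional = proj₁ (proj₁ θ-bij)

    Bij-injective : ∀ {a a' b} → θ a b → θ a' b → a ≡ a'
    Bij-injective = proj₂ (proj₁ θ-bij)

    Bij-dom : ∀ {a b} → θ a b → x a
    Bij-dom t = proj₁ (proj₁ (proj₂ θ-bij)) _ (_ , t)

    Bij-cod : ∀ {a b} → θ a b → y b
    Bij-cod t = proj₁ (proj₂ (proj₂ θ-bij)) _ (_ , t)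

    Bij-image : ∀ {a} → x a → ∃ λ b → θ a b
    Bij-image = proj₂ (proj₁ (proj₂ θ-bij)) _

    Bij-preimage : ∀ {b} → y b → ∃ λ a → θ a b
    Bij-preimage = proj₂ (proj₂ (proj₂ θ-bij)) _

    Bij-inv : Bij (inv θ) y x
    Bij-inv = (Bij-injective , Bij-functional) , proj₂ (proj₂ θ-bij) , proj₁ (proj₂ θ-bij)

    Bij-resp : ∀ {x' y'} → x' ≐ x → y ≐ y' → Bij θ x' y'
    Bij-resp x'≐x y≐y' =
      proj₁ θ-bij , ≐-trans (proj₁ (proj₂ θ-bij)) (≐-sym x'≐x) , ≐-trans (proj₂ (proj₂ θ-bij)) y≐y'

    Bij-⊆id⇒≐ : (∀ {a b} → θ a b → a ≡ b) → x ≐ y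
    Bij-⊆id⇒≐ θ⊆id =
      (λ a xa → let (b , t) = Bij-image xa in subst y (sym (θ⊆id t)) (Bij-cod t)) ,
      (λ b yb → let (a , t) = Bij-preimage yb in subst x (θ⊆id t) (Bij-dom t))

  Bij-∘ : ∀ {θ φ : GRel E} {x y z : Subset E} → Bij θ x y → Bij φ y z → Bij (φ ∘ᵣ θ) x z
  Bij-∘ {θ} {φ} {x} {y} {z} θ-bij φ-bij = (functional , injective) , dom≐ , cod≐
    where
    functional : ∀ {a c c'} → (φ ∘ᵣ θ) a c → (φ ∘ᵣ θ) a c' → c ≡ c'
    functional (_ , t , p) (_ , t' , p') =
      Bij-functional φ-bij p (subst (λ b → φ b _) (sym (Bij-functional θ-bij t t')) p')
    injective : ∀ {a a' c} → (φ ∘ᵣ θ) a c → (φ ∘ᵣ θ) a' c → a ≡ a'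
    injective (_ , t , p) (_ , t' , p') =
      Bij-injective θ-bij t (subst (θ _) (sym (Bij-injective φ-bij p p')) t')
    dom≐ : dom (φ ∘ᵣ θ) ≐ x
    dom≐ = (λ _ → λ { (_ , _ , t , _) → Bij-dom θ-bij t }) ,
           (λ _ xa → let (b , t) = Bij-image θ-bij xa
                         (c , p) = Bij-image φ-bij (Bij-cod θ-bij t)
                     in c , b , t , p)
    cod≐ : cod (φ ∘ᵣ θ) ≐ z
    cod≐ = (λ _ → λ { (_ , _ , _ , p) → Bij-cod φ-bij p }) ,
           (λ _ zc → let (b , p) = Bij-preimage φ-bij zc
                         (a , t) = Bij-preimage θ-bij (Bij-dom φ-bij p)
                     in a , b , t , p)

  Bij-idOn : ∀ {x : Subset E} → Bij (idOn x) x x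
  Bij-idOn = ((λ { (_ , refl) (_ , refl) → refl }) , (λ { (_ , refl) (_ , refl) → refl })) ,
             ((λ _ → λ { (_ , xa , _) → xa }) , (λ _ xa → _ , xa , refl)) ,
             ((λ _ → λ { (_ , xa , refl) → xa }) , (λ _ xb → _ , xb , refl))

  Bij-shunt : ∀ {θ⁻ θ⁺ ψ⁻ ψ⁺ : GRel E} {L X : Subset E} →
              Bij θ⁻ L X → Bij θ⁺ L X → Bij ψ⁻ X X → Bij ψ⁺ X X →
              (θ⁺ ∘ᵣ inv θ⁻) ⊆ᵣ (ψ⁺ ∘ᵣ ψ⁻) → (ψ⁻ ∘ᵣ θ⁻) ≐ᵣ (inv ψ⁺ ∘ᵣ θ⁺)
  Bij-shunt {θ⁻} {θ⁺} {ψ⁻} {ψ⁺} θ⁻-bij θ⁺-bij ψ⁻-bij ψ⁺-bij ⊆ψ = ⊆ , ⊇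
    where
    ⊆ : (ψ⁻ ∘ᵣ θ⁻) ⊆ᵣ (inv ψ⁺ ∘ᵣ θ⁺)
    ⊆ a d (b , t⁻ , p⁻) =
      let (c , t⁺) = Bij-image θ⁺-bij (Bij-dom θ⁻-bij t⁻)
          (d' , p⁻' , p⁺) = ⊆ψ b c (a , t⁻ , t⁺)
      in c , t⁺ , subst (λ e → ψ⁺ e c) (Bij-functional ψ⁻-bij p⁻' p⁻) p⁺
    ⊇ : (inv ψ⁺ ∘ᵣ θ⁺) ⊆ᵣ (ψ⁻ ∘ᵣ θ⁻)
    ⊇ a d (c , t⁺ , p⁺) =
      let (b , t⁻) = Bij-image θ⁻-bij (Bij-dom θ⁺-bij t⁺)
          (d' , p⁻ , p⁺') = ⊆ψ b c (a , t⁻ , t⁺)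
      in b , t⁻ , subst (ψ⁻ b) (Bij-injective ψ⁺-bij p⁺' p⁺) p⁻

  -- Iterating θ from a ∈ P must revisit a point, and injectivity cancels the revisit
  -- down to a = θⁿ(a) with n ≥ 1, which lies in Q.
  module _ {P Q : Subset E} {θ : GRel E} (P-finite : Finite P) (Q⊆P : Q ⊆ P)
           (θ-bij : IsPartialBij θ) (θ-into-Q : ∀ {a} → P a → ∃ λ b → θ a b × Q b) where

    private
      module Orbit (a : E) (pa : P a) where

        orbit : ℕ → Σ E P
        orbit zero = a , pa
        orbit (suc n) = let (b , _ , qb) = θ-into-Q (proj₂ (orbit n)) in b , Q⊆P b qb

        orbit-step : ∀ n → θ (proj₁ (orbit n)) (proj₁ (orbit (suc n)))
        orbit-step n = proj₁ (proj₂ (θ-into-Q (proj₂ (orbit n))))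

        orbit-in-Q : ∀ n → Q (proj₁ (orbit (suc n)))
        orbit-in-Q n = proj₂ (proj₂ (θ-into-Q (proj₂ (orbit n))))

        revisit⇒Q : ∀ i j → proj₁ (orbit i) ≡ proj₁ (orbit j) → i ≢ j → Q a
        revisit⇒Q zero    zero    _  i≢j = ⊥-elim (i≢j refl)
        revisit⇒Q zero    (suc j) eq _   = subst Q (sym eq) (orbit-in-Q j)
        revisit⇒Q (suc i) zero    eq _   = subst Q eq (orbit-in-Q i)
        revisit⇒Q (suc i) (suc j) eq i≢j =
          revisit⇒Q i j (proj₂ θ-bij (orbit-step i) (subst (θ _) (sym eq) (orbit-step j)))
                    (λ i≡j → i≢j (cong suc i≡j))

        l : List E
        l = proj₁ P-finite

        position : Fin (suc (length l)) → Fin (length l)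
        position n = index (proj₂ P-finite _ (proj₂ (orbit (toℕ n))))

        position-injective : ∀ m n → position m ≡ position n → proj₁ (orbit (toℕ m)) ≡ proj₁ (orbit (toℕ n))
        position-injective m n eq =
          trans (lookup-index (proj₂ P-finite _ (proj₂ (orbit (toℕ m)))))
                (trans (cong (lookup l) eq) (sym (lookup-index (proj₂ P-finite _ (proj₂ (orbit (toℕ n)))))))

        in-Q : Q a
        in-Q with pigeonhole (n<1+n (length l)) position
        ... | m , n , m<n , same-position =
          revisit⇒Q (toℕ m) (toℕ n) (position-injective m n same-position) (<⇒≢ m<n)

    finite⇒Dedekind-finite : P ⊆ Q
    finite⇒Dedekind-finite a pa = Orbit.in-Q a pa

module IsoFamilyProperties {E : Set} {IsConfig : Subset E → Set} {S : GRel E → Set}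
                           (family : IsIsoFamily IsConfig S) where
  open IsIsoFamily family

  Iso : Subset E → Subset E → Set₁
  Iso x y = ∃ λ θ → S θ × Bij θ x y

  compose-Bij : ∀ {θ φ x y z} → S θ → Bij θ x y → S φ → Bij φ y z → S (φ ∘ᵣ θ)
  compose-Bij θ-sym θ-bij φ-sym φ-bij =
    compose θ-sym φ-sym (≐-trans (proj₂ (proj₂ θ-bij)) (≐-sym (proj₁ (proj₂ φ-bij))))

  Iso-refl : ∀ {x} → IsConfig x → Iso x x
  Iso-refl x-config = idOn _ , identity x-config , Bij-idOn

  Iso-sym : ∀ {x y} → Iso x y → Iso y x
  Iso-sym (θ , θ-sym , θ-bij) = inv θ , inverse θ-sym , Bij-inv θ-bij

  Iso-trans : ∀ {x y z} → Iso x y → Iso y z → Iso x z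
  Iso-trans (θ , θ-sym , θ-bij) (φ , φ-sym , φ-bij) =
    φ ∘ᵣ θ , compose-Bij θ-sym θ-bij φ-sym φ-bij , Bij-∘ θ-bij φ-bij

  Iso-respˡ : ∀ {x x' y} → x' ≐ x → Iso x y → Iso x' y
  Iso-respˡ x'≐x (θ , θ-sym , θ-bij) = θ , θ-sym , Bij-resp θ-bij x'≐x ≐-refl

  Iso-respʳ : ∀ {x y y'} → Iso x y → y ≐ y' → Iso x y'
  Iso-respʳ (θ , θ-sym , θ-bij) y≐y' = θ , θ-sym , Bij-resp θ-bij ≐-refl y≐y'

module TCGProperties (G : TCG) where
  open TCG G
  module Sym  = IsoFamilyProperties isoS
  module Sym⁺ = IsoFamilyProperties isoS⁺
  module Sym⁻ = IsoFamilyProperties isoS⁻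

  ≅⁺⇒≅ : ∀ {x y} → x ≅⁺ y → x ≅ y
  ≅⁺⇒≅ (θ , θ-sym , θ-bij) = θ , S⁺⊆S θ-sym , θ-bij

  ≅⁻⇒≅ : ∀ {x y} → x ≅⁻ y → x ≅ y
  ≅⁻⇒≅ (θ , θ-sym , θ-bij) = θ , S⁻⊆S θ-sym , θ-bij

  -- Factor θ⁺ ∘ θ⁻⁻¹ : X ≅ X as ψ⁺ ∘ ψ⁻; then ψ⁻ ∘ θ⁻ = ψ⁺⁻¹ ∘ θ⁺ : L ≅ X is both negative
  -- and positive, hence an identity.
  canonical-≅⁻-≅⁺⇒≐ : ∀ {L X} → Canonical X → L ≅⁻ X → L ≅⁺ X → L ≐ X
  canonical-≅⁻-≅⁺⇒≐ {L} {X} X-canonical (θ⁻ , θ⁻-sym , θ⁻-bij) (θ⁺ , θ⁺-sym , θ⁺-bij)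
    with proj₁ (X-canonical (θ⁺ ∘ᵣ inv θ⁻)
                  (Sym.compose-Bij (IsIsoFamily.inverse isoS (S⁻⊆S θ⁻-sym)) (Bij-inv θ⁻-bij)
                                   (S⁺⊆S θ⁺-sym) θ⁺-bij)
                  (Bij-∘ (Bij-inv θ⁻-bij) θ⁺-bij))
  ... | ψ⁻ , ψ⁺ , ψ⁻-sym , ψ⁻-bij , ψ⁺-sym , ψ⁺-bij , factorisation =
    Bij-⊆id⇒≐ χ⁺-bij (meet-id χ⁺-sym (IsIsoFamily.resp isoS⁻ χ⁻≐χ⁺ χ⁻-sym))
    where
    χ⁻-sym : S⁻ (ψ⁻ ∘ᵣ θ⁻)
    χ⁻-sym = Sym⁻.compose-Bij θ⁻-sym θ⁻-bij ψ⁻-sym ψ⁻-bij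
    χ⁺-sym : S⁺ (inv ψ⁺ ∘ᵣ θ⁺)
    χ⁺-sym = Sym⁺.compose-Bij θ⁺-sym θ⁺-bij (IsIsoFamily.inverse isoS⁺ ψ⁺-sym) (Bij-inv ψ⁺-bij)
    χ⁺-bij : Bij (inv ψ⁺ ∘ᵣ θ⁺) L X
    χ⁺-bij = Bij-∘ θ⁺-bij (Bij-inv ψ⁺-bij)
    χ⁻≐χ⁺ : (ψ⁻ ∘ᵣ θ⁻) ≐ᵣ (inv ψ⁺ ∘ᵣ θ⁺)
    χ⁻≐χ⁺ = Bij-shunt θ⁻-bij θ⁺-bij ψ⁻-bij ψ⁺-bij (proj₁ factorisation)

module CopycatProperties (A : Arena) where
  open Arena A
  open Copycat A
  open TCGProperties tcg

  other : Side → Side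
  other one = two
  other two = one

  other-involutive : ∀ i → other (other i) ≡ i
  other-involutive one = refl
  other-involutive two = refl

  side : Side → Subset CEv → Subset Ev
  side i z a = z (i , a)

  minus≢plus : minus ≢ plus
  minus≢plus ()

  flip-involutive : ∀ p → flip (flip p) ≡ p
  flip-involutive minus = refl
  flip-involutive plus  = refl

  polcc-other : ∀ i a → polcc (other i , a) ≡ flip (polcc (i , a))
  polcc-other one a = sym (flip-involutive (pol a))
  polcc-other two a = refl

  polcc-resp-pol : ∀ i {a b} → pol a ≡ pol b → polcc (i , a) ≡ polcc (i , b)
  polcc-resp-pol one eq = cong flip eq
  polcc-resp-pol two eq = eq

  copy-≤cc : ∀ i {a} → polcc (i , a) ≡ plus → (other i , a) ≤cc (i , a)
  copy-≤cc i {a} pos = inj₂ (inj₂ (refl , trans (polcc-other i a) (cong flip pos) , pos))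

  opposite-side : ∀ i j {a} → polcc (i , a) ≡ minus → polcc (j , a) ≡ plus → j ≡ other i
  opposite-side one one neg pos = ⊥-elim (minus≢plus (trans (sym neg) pos))
  opposite-side one two _   _   = refl
  opposite-side two one _   _   = refl
  opposite-side two two neg pos = ⊥-elim (minus≢plus (trans (sym neg) pos))

  module _ {z : Subset CEv} (z-config : IsConfigCC z) where
    open IsConfigOf z-config

    positive-copied : ∀ i {a} → polcc (i , a) ≡ plus → z (i , a) → z (other i , a)
    positive-copied i pos = downClosed (copy-≤cc i pos)

    events : List Ev
    events = map proj₂ (proj₁ finite)

    side-⊆-events : ∀ i a → z (i , a) → a ∈ events
    side-⊆-events i a za = ∈-map⁺ proj₂ (proj₂ finite (i , a) za)

    -- The negative events of side i lie in side (other i) by counting: a symmetry matches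
    -- them injectively with the negative events of side (other i), whose copies they are.
    side-≅⇒⊆ : ∀ i → side i z ≅ side (other i) z → side i z ⊆ side (other i) z
    side-≅⇒⊆ i (θ , θ-sym , θ-bij) a za with polcc (i , a) in pol-a
    ... | plus  = positive-copied i pol-a za
    ... | minus = proj₁ (finite⇒Dedekind-finite finite-P Q⊆P (proj₁ θ-bij) θ-into-Q a
                                               (za , trans (polcc-other i a) (cong flip pol-a)))
      where
      P Q : Subset Ev
      P b = z (i , b) × polcc (other i , b) ≡ plus
      Q b = z (other i , b) × polcc (other i , b) ≡ plus

      finite-P : Finite P
      finite-P = events , λ b pb → side-⊆-events i b (proj₁ pb)

      Q⊆P : Q ⊆ P
      Q⊆P b (zb , pos) =
        subst (λ k → z (k , b)) (other-involutive i) (positive-copied (other i) pos zb) , pos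

      θ-into-Q : ∀ {b} → P b → ∃ λ c → θ b c × Q c
      θ-into-Q (zb , pos) =
        let (c , t) = Bij-image θ-bij zb
        in c , t , Bij-cod θ-bij t , trans (polcc-resp-pol (other i) (sym (pol-pres θ-sym t))) pos

    sides-≅⇒≐ : left z ≅ right z → left z ≐ right z
    sides-≅⇒≐ z₁≅z₂ = side-≅⇒⊆ one z₁≅z₂ , side-≅⇒⊆ two (Sym.Iso-sym z₁≅z₂)

    module _ (z-plusCovered : PlusCovered z) where

      negative-¬¬copied : ∀ i {a} → polcc (i , a) ≡ minus → z (i , a) → ¬ ¬ z (other i , a)
      negative-¬¬copied i {a} neg za ¬copy =
        minus≢plus (trans (sym neg) (z-plusCovered (i , a) (za , maximal)))
        where
        maximal : ∀ e → z e → (i , a) ≤cc e → e ≡ (i , a)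
        maximal _       _  (inj₁ eq)                      = sym eq
        maximal _       ze (inj₂ (inj₁ a<b))              = ⊥-elim (¬copy (downClosed (inj₂ (inj₁ a<b)) ze))
        maximal (j , _) ze (inj₂ (inj₂ (refl , _ , pos))) =
          ⊥-elim (¬copy (subst (λ k → z (k , a)) (opposite-side i j neg pos) ze))

      ¬¬copied : ∀ i {a} → z (i , a) → ¬ ¬ z (other i , a)
      ¬¬copied i {a} za with polcc (i , a) in pol-a
      ... | plus  = λ ¬copy → ¬copy (positive-copied i pol-a za)
      ... | minus = negative-¬¬copied i pol-a za

      ¬¬copy-map : ∀ i a → ¬ ¬ (z (i , a) → z (other i , a))
      ¬¬copy-map i a = ¬¬-map copy-map ¬¬-excluded-middle
        where
        copy-map : Dec (z (other i , a)) → z (i , a) → z (other i , a)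
        copy-map (yes copy) = const copy
        copy-map (no ¬copy) za = ⊥-elim (¬¬copied i za ¬copy)

      ¬¬sides-≐ : ¬ ¬ (left z ≐ right z)
      ¬¬sides-≐ = ¬¬-map sides-≐ (sequenceM 0ℓ ¬¬-Monad (tabulate λ {a} _ → ¬¬copy-maps a))
        where
        ¬¬copy-maps : ∀ a → ¬ ¬ ((z (one , a) → z (two , a)) × (z (two , a) → z (one , a)))
        ¬¬copy-maps a both = ¬¬copy-map one a λ f → ¬¬copy-map two a λ g → both (f , g)
        sides-≐ : All (λ a → (z (one , a) → z (two , a)) × (z (two , a) → z (one , a))) events →
                  left z ≐ right z
        sides-≐ maps =
          (λ a za → proj₁ (All.lookup maps (side-⊆-events one a za)) za) ,
          (λ a za → proj₂ (All.lookup maps (side-⊆-events two a za)) za)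

  diagonal : Subset Ev → Subset CEv
  diagonal x (_ , a) = x a

  diagonal-config : ∀ {x} → IsConfig x → IsConfigCC (diagonal x)
  diagonal-config {x} x-config = record
    { finite       = map (one ,_) l ++ map (two ,_) l , in-list
    ; downClosed   = λ {e} {e'} → down-closed {e} {e'}
    ; conflictFree = λ {e} {e'} → conflictFree {proj₂ e} {proj₂ e'}
    }
    where
    open IsConfigOf x-config
    l : List Ev
    l = proj₁ finite
    in-list : ∀ e → diagonal x e → e ∈ map (one ,_) l ++ map (two ,_) l
    in-list (one , a) xa = ∈-++⁺ˡ (∈-map⁺ (one ,_) (proj₂ finite a xa))
    in-list (two , a) xa = ∈-++⁺ʳ (map (one ,_) l) (∈-map⁺ (two ,_) (proj₂ finite a xa))
    down-closed : ∀ {e e'} → e' ≤cc e → diagonal x e → diagonal x e'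
    down-closed (inj₁ refl)                  xa = xa
    down-closed (inj₂ (inj₁ (a'≤a , _)))     xa = downClosed a'≤a xa
    down-closed (inj₂ (inj₂ (refl , _ , _))) xa = xa

  diagonal-plusCovered : ∀ x → PlusCovered (diagonal x)
  diagonal-plusCovered x (i , a) (xa , maximal) with polcc (i , a) in pol-a
  ... | plus  = refl
  ... | minus = ⊥-elim (other-≢ i (cong proj₁ (maximal (other i , a) xa (inj₂ (inj₂ (refl , refl , pos))))))
    where
    pos : polcc (other i , a) ≡ plus
    pos = trans (polcc-other i a) (cong flip pol-a)
    other-≢ : ∀ i → other i ≢ i
    other-≢ one ()
    other-≢ two ()

  diagonal-wit⁺ : ∀ {x} → IsConfig x → wit⁺ x x (diagonal x)
  diagonal-wit⁺ x-config = diagonal-config x-config , diagonal-plusCovered _ ,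
                           Sym⁻.Iso-refl x-config , Sym⁺.Iso-refl x-config

  wit⁺-respʳ : ∀ {x y y' z} → y ≐ y' → wit⁺ x y z → wit⁺ x y' z
  wit⁺-respʳ y≐y' (z-config , z-plusCovered , z₁≅⁻x , z₂≅⁺y) =
    z-config , z-plusCovered , z₁≅⁻x , Sym⁺.Iso-respʳ z₂≅⁺y y≐y'

  sides-≐⇒≐diagonal : ∀ {z x} → left z ≐ x → right z ≐ x → z ≐ diagonal x
  sides-≐⇒≐diagonal (z₁⊆x , x⊆z₁) (z₂⊆x , x⊆z₂) =
    (λ { (one , a) → z₁⊆x a ; (two , a) → z₂⊆x a }) ,
    (λ { (one , a) → x⊆z₁ a ; (two , a) → x⊆z₂ a })

  wit⁺-canonical⇒≐diagonal : ∀ {x z} → Canonical x → wit⁺ x x z → z ≐ diagonal x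
  wit⁺-canonical⇒≐diagonal {x} {z} x-canonical (z-config , _ , z₁≅⁻x , z₂≅⁺x) =
    sides-≐⇒≐diagonal z₁≐x (≐-trans (≐-sym z₁≐z₂) z₁≐x)
    where
    z₁≐z₂ : left z ≐ right z
    z₁≐z₂ = sides-≅⇒≐ z-config (Sym.Iso-trans (≅⁻⇒≅ z₁≅⁻x) (Sym.Iso-sym (≅⁺⇒≅ z₂≅⁺x)))
    z₁≐x : left z ≐ x
    z₁≐x = canonical-≅⁻-≅⁺⇒≐ x-canonical z₁≅⁻x (Sym⁺.Iso-respˡ z₁≐z₂ z₂≅⁺x)

  wit⁺⇒¬¬≅ : ∀ {x y z} → wit⁺ x y z → ¬ ¬ (x ≅ y)
  wit⁺⇒¬¬≅ {x} {y} {z} (z-config , z-plusCovered , z₁≅⁻x , z₂≅⁺y) =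
    ¬¬-map x≅y (¬¬sides-≐ z-config z-plusCovered)
    where
    x≅y : left z ≐ right z → x ≅ y
    x≅y z₁≐z₂ = Sym.Iso-trans (Sym.Iso-sym (≅⁻⇒≅ z₁≅⁻x)) (Sym.Iso-respˡ z₁≐z₂ (≅⁺⇒≅ z₂≅⁺y))

proposition5p4 : (A : Arena) → let open Arena A in let open Copycat A in
    (x y : Subset Ev) (cx : Complete x) (cy : Complete y) →
    ((x ≅ y) →
       (∃ λ z → wit⁺ (hat x cx) (hat y cy) z)
       × (∀ z z' → wit⁺ (hat x cx) (hat y cy) z → wit⁺ (hat x cx) (hat y cy) z' → z ≐ z'))
    × (¬ (x ≅ y) → ∀ z → ¬ wit⁺ (hat x cx) (hat y cy) z)
proposition5p4 A x y cx cy = (λ x≅y → existence x≅y , uniqueness x≅y) , nonexistence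
  where
  open Arena A
  open Copycat A
  open CopycatProperties A
  open TCGProperties tcg

  existence : x ≅ y → ∃ λ z → wit⁺ (hat x cx) (hat y cy) z
  existence x≅y = diagonal (hat x cx) ,
                  wit⁺-respʳ (hat-class x y cx cy x≅y) (diagonal-wit⁺ (hat-config x cx))

  uniqueness : x ≅ y → ∀ z z' → wit⁺ (hat x cx) (hat y cy) z → wit⁺ (hat x cx) (hat y cy) z' → z ≐ z'
  uniqueness x≅y z z' w w' = ≐-trans (≐diagonal w) (≐-sym (≐diagonal w'))
    where
    ≐diagonal : ∀ {z} → wit⁺ (hat x cx) (hat y cy) z → z ≐ diagonal (hat x cx)
    ≐diagonal w = wit⁺-canonical⇒≐diagonal (hat-canon x cx)
                    (wit⁺-respʳ (≐-sym (hat-class x y cx cy x≅y)) w)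

  nonexistence : ¬ (x ≅ y) → ∀ z → ¬ wit⁺ (hat x cx) (hat y cy) z
  nonexistence x≇y z w = wit⁺⇒¬¬≅ w λ x̂≅ŷ →
    x≇y (Sym.Iso-trans (hat-member x cx) (Sym.Iso-trans x̂≅ŷ (Sym.Iso-sym (hat-member y cy))))
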